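{- Let $X$ be a set with $|X|=4$. Then there exist $\alpha,\beta\in\mathcal{P}(X)\setminus\{\emptyset,\mathrm{id}_X\}$ such that the distance between $\alpha$ and $\beta$ in the commuting graph $\mathcal{G}(\mathcal{P}(X))$ is at least $4$.
   Context: $\mathcal{P}(X)$ is the partial transformation semigroup on $X$: all functions whose domain and image are subsets of $X$ (including the empty map $\emptyset$), with composition as multiplication (maps act on the right). Its center is $\{\emptyset,\mathrm{id}_X\}$. For a finite non-commutative semigroup $S$, the commuting graph $\mathcal{G}(S)$ is the simple graph with vertex set $S\setminus Z(S)$ ($Z(S)$ the center), two distinct vertices $x,y$ being adjacent iff $xy=yx$. The distance between two vertices is the length of a shortest path between them ($\infty$ if none). -}

module Defs where

open import Data.Nat using (ℕ; zero; suc)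
open import Data.Fin using (Fin)
open import Data.Maybe using (Maybe; just; nothing)
open import Data.Vec using (Vec; lookup; tabulate)
open import Data.Product using (_×_)
open import Relation.Binary.PropositionalEquality using (_≡_; _≢_)
open import Relation.Nullary using (¬_)

X : Set
X = Fin 4

-- A partial transformation of X: the value at x is  just y  if x is in the
-- domain and maps to y, and  nothing  if x is outside the domain.
-- Represented as a vector so that _≡_ is extensional equality of partial maps.
PT : Set
PT = Vec (Maybe X) 4

app : PT → X → Maybe X
app α x = lookup α x

-- composition, maps acting on the right:  x (α ∘ β) = (x α) β
_·_ : PT → PT → PT
α · β = tabulate λ x → go (app α x)
  where
  go : Maybe X → Maybe X
  go nothing  = nothing
  go (just y) = app β y

emptyMap : PT
emptyMap = tabulate λ _ → nothing

idMap : PT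
idMap = tabulate just

Central : PT → Set
Central z = ∀ s → z · s ≡ s · z

Adj : PT → PT → Set
Adj x y = ¬ Central x × ¬ Central y × x ≢ y × x · y ≡ y · x

data Walk : PT → PT → ℕ → Set where
  here : ∀ {x} → Walk x x zero
  step : ∀ {x y z n} → Adj x y → Walk y z n → Walk x z (suc n)

-- α is the chain 3 ↦ 2 ↦ 1 ↦ 0 with 0 outside the domain, β the same chain
-- with 0 fixed. An exhaustive search over the 5⁴ partial maps shows that each
-- of them is centralized only by ∅, id and its own powers, so every neighbour
-- of α is a power of α and every neighbour of β a power of β. No power of α
-- commutes with a power of β (in particular none is one), which rules out the
-- paths α – β, α – g – β and α – g – h – β.
module Submission where

open import Defs
import Data.Nat as ℕ
open import Data.Nat using (_≤_; s≤s; z≤n)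
open import Data.Fin using (zero; suc)
import Data.Fin.Properties as Fin
open import Data.List using (List; []; _∷_)
open import Data.List.Membership.Propositional using (_∈_)
open import Data.List.Relation.Unary.Any using (here; there)
open import Data.Maybe using (Maybe; just; nothing)
import Data.Maybe.Properties as Maybe
open import Data.Vec using (Vec; []; _∷_)
import Data.Vec.Properties as Vec
open import Data.Product using (Σ; _×_; _,_)
open import Data.Empty using (⊥-elim)
open import Relation.Binary.PropositionalEquality using (_≡_; refl; sym)
open import Relation.Nullary using (¬_; Dec)
open import Relation.Nullary.Decidable using (map′; _×-dec_; _→-dec_; True; toWitness)
open import Relation.Unary using (Decidable)

Exhaustible : Set → Set₁
Exhaustible A = ∀ {P : A → Set} → Decidable P → Dec (∀ x → P x)

exhaustible-Maybe : ∀ {A} → Exhaustible A → Exhaustible (Maybe A)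
exhaustible-Maybe all? P? =
  map′ (λ { (p₀ , _) nothing → p₀ ; (_ , pⱼ) (just x) → pⱼ x })
       (λ p → p nothing , λ x → p (just x))
       (P? nothing ×-dec all? (λ x → P? (just x)))

exhaustible-Vec : ∀ {A} → Exhaustible A → ∀ n → Exhaustible (Vec A n)
exhaustible-Vec all? ℕ.zero P? =
  map′ (λ { p [] → p }) (λ p → p []) (P? [])
exhaustible-Vec all? (ℕ.suc n) P? =
  map′ (λ { p (x ∷ xs) → p x xs }) (λ p x xs → p (x ∷ xs))
       (all? λ x → exhaustible-Vec all? n λ xs → P? (x ∷ xs))

exhaustible-PT : Exhaustible PT
exhaustible-PT = exhaustible-Vec (exhaustible-Maybe Fin.all?) 4

_≟_ : (f g : PT) → Dec (f ≡ g)
_≟_ = Vec.≡-dec (Maybe.≡-dec Fin._≟_)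

open import Data.List.Membership.DecPropositional _≟_ using (_∈?_)

by-search : ∀ {P : PT → Set} (P? : Decidable P) → {True (exhaustible-PT P?)} → ∀ g → P g
by-search P? {found} = toWitness found

emptyMap-central : Central emptyMap
emptyMap-central = by-search (λ s → (emptyMap · s) ≟ (s · emptyMap))

idMap-central : Central idMap
idMap-central = by-search (λ s → (idMap · s) ≟ (s · idMap))

_Commutes_ : PT → PT → Set
f Commutes g = f · g ≡ g · f

powers : PT → List PT
powers f = f ∷ f · f ∷ (f · f) · f ∷ []

Adj-sym : ∀ {f g} → Adj f g → Adj g f
Adj-sym (f-nc , g-nc , f≢g , fg≡gf) = g-nc , f-nc , (λ g≡f → f≢g (sym g≡f)) , sym fg≡gf

neighbour-∈ : ∀ {f g} rest → (∀ h → f Commutes h → h ∈ emptyMap ∷ idMap ∷ f ∷ rest) →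
              Adj f g → g ∈ rest
neighbour-∈ {g = g} rest centralizer (_ , g-nc , f≢g , fg≡gf) with centralizer g fg≡gf
... | here refl                 = ⊥-elim (g-nc emptyMap-central)
... | there (here refl)         = ⊥-elim (g-nc idMap-central)
... | there (there (here refl)) = ⊥-elim (f≢g refl)
... | there (there (there g∈))  = g∈

α β : PT
α = nothing ∷ just zero ∷ just (suc zero) ∷ just (suc (suc zero)) ∷ []
β = just zero ∷ just zero ∷ just (suc zero) ∷ just (suc (suc zero)) ∷ []

centralizer-α : ∀ g → α Commutes g → g ∈ emptyMap ∷ idMap ∷ powers α
centralizer-α = by-search λ g → ((α · g) ≟ (g · α)) →-dec (g ∈? emptyMap ∷ idMap ∷ powers α)

centralizer-β : ∀ g → β Commutes g → g ∈ emptyMap ∷ idMap ∷ powers β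
centralizer-β = by-search λ g → ((β · g) ≟ (g · β)) →-dec (g ∈? emptyMap ∷ idMap ∷ powers β)

neighbour-α : ∀ {g} → Adj α g → g ∈ powers α
neighbour-α αg = there (neighbour-∈ _ centralizer-α αg)

neighbour-β : ∀ {g} → Adj g β → g ∈ powers β
neighbour-β gβ = there (neighbour-∈ _ centralizer-β (Adj-sym gβ))

powers-α-noncommuting-powers-β : ∀ {g h} → g ∈ powers α → h ∈ powers β → ¬ g Commutes h
powers-α-noncommuting-powers-β (here refl)                 (here refl)                 ()
powers-α-noncommuting-powers-β (here refl)                 (there (here refl))         ()
powers-α-noncommuting-powers-β (here refl)                 (there (there (here refl))) ()
powers-α-noncommuting-powers-β (there (here refl))         (here refl)                 ()
powers-α-noncommuting-powers-β (there (here refl))         (there (here refl))         ()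
powers-α-noncommuting-powers-β (there (here refl))         (there (there (here refl))) ()
powers-α-noncommuting-powers-β (there (there (here refl))) (here refl)                 ()
powers-α-noncommuting-powers-β (there (there (here refl))) (there (here refl))         ()
powers-α-noncommuting-powers-β (there (there (here refl))) (there (there (here refl))) ()

α-noncommuting-β : ¬ α Commutes β
α-noncommuting-β = powers-α-noncommuting-powers-β (here refl) (here refl)

distance-α-β : ∀ n → Walk α β n → 4 ≤ n
distance-α-β _ (step (_ , _ , _ , αβ≡βα) here) = ⊥-elim (α-noncommuting-β αβ≡βα)
distance-α-β _ (step αg (step gβ here)) =
  ⊥-elim (powers-α-noncommuting-powers-β (neighbour-α αg) (neighbour-β gβ) refl)
distance-α-β _ (step αg (step (_ , _ , _ , gh≡hg) (step hβ here))) =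
  ⊥-elim (powers-α-noncommuting-powers-β (neighbour-α αg) (neighbour-β hβ) gh≡hg)
distance-α-β _ (step _ (step _ (step _ (step _ _)))) = s≤s (s≤s (s≤s (s≤s z≤n)))

lemma3p11 : Σ PT λ α → Σ PT λ β →
    ¬ Central α × ¬ Central β × (∀ n → Walk α β n → 4 ≤ n)
lemma3p11 = α , β
          , (λ central → α-noncommuting-β (central β))
          , (λ central → α-noncommuting-β (sym (central α)))
          , distance-α-β
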